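{- Let $\vec S$ be a universe of set separations of a set $V$ with the order function $|X,Y|_r=r(X)+r(Y)-r(V)$ for some non-negative non-decreasing submodular function $r:2^V\to\mathbb N$. If $\sigma$ is a star (of elements of $\vec S$) and $(A,B)\in\sigma$, then $\langle\sigma\rangle_r\ge|A,B|_r$. Also, if $\sigma$ is a star and $\sigma\cup\{(A,B)\}$ is a star, then $\langle\sigma\rangle_r\ge r(A)$.
   Context: $\mathrm{sep}(V)=\{(A,B):A\cup B=V\}$ is ordered by $(A,B)\le(C,D)$ iff $A\subseteq C$ and $B\supseteq D$. A universe of set separations is a subset $\vec S\subseteq\mathrm{sep}(V)$ closed under $(A,B)\mapsto(B,A)$ and under $(A,B)\wedge(C,D)=(A\cap C,B\cup D)$ and $(A,B)\vee(C,D)=(A\cup C,B\cap D)$. A star is a finite multiset $\sigma$ of separations such that any two of its members (distinct as members of the multiset) $(A,B),(C,D)$ satisfy $(A,B)\le(D,C)$; $\sigma\cup\{(A,B)\}$ denotes the multiset obtained by adding one copy of $(A,B)$. For a star $\sigma=\{(A_0,B_0),\dots,(A_n,B_n)\}$ (with $n\ge0$), its size is $\langle\sigma\rangle_r=\sum_{i=0}^n r(B_i)-n\,r(V)$. -}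

module Defs where

open import Level using (0ℓ)
open import Data.Nat using (ℕ; _≤_)
open import Data.Integer as ℤ using (ℤ; +_)
open import Data.Sum using (_⊎_; inj₁; inj₂)
open import Data.Product using (_×_; _,_)
open import Data.List using (List; []; _∷_; length; lookup; map)
open import Data.Nat.ListAction using (sum)
open import Data.Fin using (Fin)
open import Relation.Binary.PropositionalEquality using (_≢_)
open import Relation.Unary using (Pred; _⊆_; _∪_; _∩_; U)

record Sep (V : Set) : Set₁ where
  constructor sep
  field
    A B : Pred V 0ℓ
    cover : ∀ v → (A ∪ B) v
open Sep public

_≤ₛ_ : {V : Set} → Sep V → Sep V → Set
s ≤ₛ t = (A s ⊆ A t) × (B t ⊆ B s)

inv : {V : Set} → Sep V → Sep V
inv (sep a b c) = sep b a (λ v → swap (c v))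
  where
  swap : ∀ {P Q : Set} → P ⊎ Q → Q ⊎ P
  swap (inj₁ x) = inj₂ x
  swap (inj₂ y) = inj₁ y

_∧ₛ_ : {V : Set} → Sep V → Sep V → Sep V
s ∧ₛ t = sep (A s ∩ A t) (B s ∪ B t) cv
  where
  cv : ∀ v → ((A s ∩ A t) ∪ (B s ∪ B t)) v
  cv v with cover s v | cover t v
  ... | inj₁ x | inj₁ y = inj₁ (x , y)
  ... | inj₂ x | _      = inj₂ (inj₁ x)
  ... | inj₁ _ | inj₂ y = inj₂ (inj₂ y)

-- (A,B) ∨ (C,D) = (A ∪ C , B ∩ D)
_∨ₛ_ : {V : Set} → Sep V → Sep V → Sep V
s ∨ₛ t = inv (inv s ∧ₛ inv t)

record IsUniverse {V : Set} (S : Pred (Sep V) 0ℓ) : Set₁ where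
  field
    inv-closed  : ∀ {s} → S s → S (inv s)
    meet-closed : ∀ {s t} → S s → S t → S (s ∧ₛ t)
    join-closed : ∀ {s t} → S s → S t → S (s ∨ₛ t)

-- r : 2^V → ℕ (non-negative automatically), non-decreasing and submodular
record IsSubmodularRank {V : Set} (r : Pred V 0ℓ → ℕ) : Set₁ where
  field
    monotone   : ∀ {X Y} → X ⊆ Y → r X ≤ r Y
    submodular : ∀ X Y → r (X ∪ Y) Data.Nat.+ r (X ∩ Y) ≤ r X Data.Nat.+ r Y

∣_,_∣[_] : {V : Set} → Pred V 0ℓ → Pred V 0ℓ → (Pred V 0ℓ → ℕ) → ℤ
∣ X , Y ∣[ r ] = (+ r X ℤ.+ + r Y) ℤ.- + r U

-- A star: a finite multiset (list) of separations such that any two members at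
-- distinct positions (A,B), (C,D) satisfy (A,B) ≤ (D,C).
IsStar : {V : Set} → List (Sep V) → Set
IsStar σ = ∀ (i j : Fin (length σ)) → i ≢ j → lookup σ i ≤ₛ inv (lookup σ j)

-- size of a nonempty star {(A_0,B_0),…,(A_n,B_n)} (given as s ∷ σ, n = length σ):
-- ⟨σ⟩_r = Σ r(B_i) − n r(V)
size : {V : Set} → (Pred V 0ℓ → ℕ) → Sep V → List (Sep V) → ℤ
size r s σ = + sum (map (λ t → r (B t)) (s ∷ σ)) ℤ.- (+ length σ ℤ.* + r U)

module Submission where

open import Defs
open import Level using (0ℓ)
open import Data.Nat using (ℕ)
open import Data.Integer using (_≥_; +_)
open import Data.Product using (_×_)
open import Data.List using (List; _∷_; length; lookup)
open import Data.List.Relation.Unary.All using (All)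
open import Data.Fin using (Fin)
open import Relation.Unary using (Pred)

open import Data.Nat using (_+_; _*_; _≤_)
import Data.Nat.Properties as ℕ
import Data.Integer as ℤ
import Data.Integer.Properties as ℤ
open import Data.Fin using (zero; suc)
open import Data.Fin.Properties using (suc-injective)
open import Data.List using ([]; map; removeAt)
open import Data.List.Properties using (length-removeAt)
open import Data.Nat.ListAction using (sum)
open import Data.Product using (_,_; proj₁)
open import Data.Sum using (inj₁; inj₂)
open import Function using (_∘_)
open import Relation.Binary.PropositionalEquality
open import Relation.Unary using (_⊆_; _∪_; _∩_; U)
open import Algebra.Properties.CommutativeSemigroup ℕ.+-commutativeSemigroup
  using (x∙yz≈y∙xz; x∙yz≈zx∙y; xy∙z≈y∙zx)

-- Let σ = (A₀,B₀),…,(Aₙ,Bₙ) be a star.  Intersecting V with B₀, B₁, … one at a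
-- time, submodularity applied to the cover (V ∩ B₀ ∩ … ∩ Bₖ₋₁) ∪ Bₖ = V (which
-- holds since Aₖ lies in every earlier Bⱼ) pays one r(V) for each Bₖ, so
-- (n+1) r(V) + r(Y) ≤ Σ r(Bₖ) + r(V) for every Y contained in all the Bₖ.
-- Taking Y = A of the added separation gives the second claim; taking Y = Aᵢ
-- for the star with its i-th member removed gives the first.

module _ {a} {A : Set a} where

  removeAt-index : (xs : List A) (i : Fin (length xs)) →
                   Fin (length (removeAt xs i)) → Fin (length xs)
  removeAt-index (x ∷ xs) zero    j       = suc j
  removeAt-index (x ∷ xs) (suc i) zero    = zero
  removeAt-index (x ∷ xs) (suc i) (suc j) = suc (removeAt-index xs i j)

  lookup-removeAt : ∀ (xs : List A) i j →
                    lookup (removeAt xs i) j ≡ lookup xs (removeAt-index xs i j)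
  lookup-removeAt (x ∷ xs) zero    j       = refl
  lookup-removeAt (x ∷ xs) (suc i) zero    = refl
  lookup-removeAt (x ∷ xs) (suc i) (suc j) = lookup-removeAt xs i j

  removeAt-index-injective : ∀ (xs : List A) i {j k} →
                             removeAt-index xs i j ≡ removeAt-index xs i k → j ≡ k
  removeAt-index-injective (x ∷ xs) zero    refl = refl
  removeAt-index-injective (x ∷ xs) (suc i) {zero}  {zero}  _  = refl
  removeAt-index-injective (x ∷ xs) (suc i) {suc j} {suc k} eq =
    cong suc (removeAt-index-injective xs i (suc-injective eq))

  removeAt-index≢ : ∀ (xs : List A) i j → removeAt-index xs i j ≢ i
  removeAt-index≢ (x ∷ xs) zero    j       ()
  removeAt-index≢ (x ∷ xs) (suc i) zero    ()
  removeAt-index≢ (x ∷ xs) (suc i) (suc j) = removeAt-index≢ xs i j ∘ suc-injective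

  sum-map-removeAt : ∀ (f : A → ℕ) (xs : List A) i →
                     sum (map f xs) ≡ f (lookup xs i) + sum (map f (removeAt xs i))
  sum-map-removeAt f (x ∷ xs) zero    = refl
  sum-map-removeAt f (x ∷ xs) (suc i) = begin
    f x + sum (map f xs)                                   ≡⟨ cong (λ z → f x + z) (sum-map-removeAt f xs i) ⟩
    f x + (f (lookup xs i) + sum (map f (removeAt xs i)))  ≡⟨ x∙yz≈y∙xz (f x) (f (lookup xs i)) _ ⟩
    f (lookup xs i) + (f x + sum (map f (removeAt xs i)))  ∎
    where open ≡-Reasoning

IsStar-removeAt : ∀ {V} (σ : List (Sep V)) i → IsStar σ → IsStar (removeAt σ i)
IsStar-removeAt σ i star j k j≢k
  rewrite lookup-removeAt σ i j | lookup-removeAt σ i k =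
  star _ _ (j≢k ∘ removeAt-index-injective σ i)

m+q≤p+n⇒m-n≤p-q : ∀ m n p q → m + q ≤ p + n → + m ℤ.- + n ℤ.≤ + p ℤ.- + q
m+q≤p+n⇒m-n≤p-q m n p q m+q≤p+n = begin
  + m ℤ.- + n             ≡⟨ ℤ.m-n≡m⊖n m n ⟩
  m ℤ.⊖ n                 ≡⟨ ℤ.+-cancelˡ-⊖ q m n ⟨
  (q + m) ℤ.⊖ (q + n)     ≤⟨ ℤ.⊖-monoˡ-≤ (q + n) q+m≤n+p ⟩
  (n + p) ℤ.⊖ (q + n)     ≡⟨ cong ((n + p) ℤ.⊖_) (ℕ.+-comm q n) ⟩
  (n + p) ℤ.⊖ (n + q)     ≡⟨ ℤ.+-cancelˡ-⊖ n p q ⟩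
  p ℤ.⊖ q                 ≡⟨ ℤ.m-n≡m⊖n p q ⟨
  + p ℤ.- + q             ∎
  where
  open ℤ.≤-Reasoning
  q+m≤n+p : q + m ≤ n + p
  q+m≤n+p = subst₂ _≤_ (ℕ.+-comm m q) (ℕ.+-comm p n) m+q≤p+n

m+n≤p⇒m≤p-n : ∀ m n p → m + n ≤ p → + m ℤ.≤ + p ℤ.- + n
m+n≤p⇒m≤p-n m n p m+n≤p =
  subst (ℤ._≤ + p ℤ.- + n) (ℤ.+-identityʳ (+ m))
    (m+q≤p+n⇒m-n≤p-q m 0 p n (subst (m + n ≤_) (sym (ℕ.+-identityʳ p)) m+n≤p))

module _ {V : Set} {r : Pred V 0ℓ → ℕ} (R : IsSubmodularRank r) where
  open IsSubmodularRank R

  sumB : List (Sep V) → ℕ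
  sumB σ = sum (map (λ t → r (B t)) σ)

  submodular-cover : ∀ {X Y} → (∀ v → (X ∪ Y) v) → r U + r (X ∩ Y) ≤ r X + r Y
  submodular-cover {X} {Y} X∪Y=V =
    ℕ.≤-trans (ℕ.+-monoˡ-≤ (r (X ∩ Y)) (monotone (λ {v} _ → X∪Y=V v))) (submodular X Y)

  star-bound : (σ : List (Sep V)) → IsStar σ → {X Y : Pred V 0ℓ} →
               (∀ j → A (lookup σ j) ⊆ X) → Y ⊆ X → (∀ j → Y ⊆ B (lookup σ j)) →
               length σ * r U + r Y ≤ sumB σ + r X
  star-bound []      _    _    Y⊆X _   = monotone Y⊆X
  star-bound (t ∷ σ) star {X} {Y} A⊆X Y⊆X Y⊆B = begin
    (r U + length σ * r U) + r Y  ≡⟨ ℕ.+-assoc (r U) _ _ ⟩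
    r U + (length σ * r U + r Y)  ≤⟨ ℕ.+-monoʳ-≤ (r U) ih ⟩
    r U + (sumB σ + r (X ∩ B t))  ≡⟨ x∙yz≈y∙xz (r U) (sumB σ) _ ⟩
    sumB σ + (r U + r (X ∩ B t))  ≤⟨ ℕ.+-monoʳ-≤ (sumB σ) (submodular-cover X∪Bt=V) ⟩
    sumB σ + (r X + r (B t))      ≡⟨ x∙yz≈zx∙y (sumB σ) (r X) (r (B t)) ⟩
    (r (B t) + sumB σ) + r X      ∎
    where
    open ℕ.≤-Reasoning
    ih : length σ * r U + r Y ≤ sumB σ + r (X ∩ B t)
    ih = star-bound σ (IsStar-removeAt (t ∷ σ) zero star)
           (λ j x → A⊆X (suc j) x , proj₁ (star (suc j) zero λ ()) x)
           (λ y → Y⊆X y , Y⊆B zero y) (Y⊆B ∘ suc)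
    X∪Bt=V : ∀ v → (X ∪ B t) v
    X∪Bt=V v with cover t v
    ... | inj₁ a = inj₁ (A⊆X zero a)
    ... | inj₂ b = inj₂ b

  size≡ : ∀ s σ → size r s σ ≡ + sumB (s ∷ σ) ℤ.- + (length σ * r U)
  size≡ s σ = cong (λ n → + sumB (s ∷ σ) ℤ.- n) (sym (ℤ.pos-* (length σ) (r U)))

  size≥order : ∀ s σ → IsStar (s ∷ σ) → (i : Fin (length (s ∷ σ))) →
               size r s σ ≥ ∣ A (lookup (s ∷ σ) i) , B (lookup (s ∷ σ) i) ∣[ r ]
  size≥order s σ star i rewrite size≡ s σ =
    m+q≤p+n⇒m-n≤p-q (a + b) (r U) (sumB τ) (length σ * r U) (begin
      (a + b) + length σ * r U     ≡⟨ xy∙z≈y∙zx a b _ ⟩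
      b + (length σ * r U + a)     ≡⟨ cong (λ n → b + (n * r U + a)) (length-removeAt τ i) ⟨
      b + (length τ∖i * r U + a)   ≤⟨ ℕ.+-monoʳ-≤ b bound ⟩
      b + (sumB τ∖i + r U)         ≡⟨ ℕ.+-assoc b _ _ ⟨
      (b + sumB τ∖i) + r U         ≡⟨ cong (λ z → z + r U) (sum-map-removeAt (r ∘ B) τ i) ⟨
      sumB τ + r U                 ∎)
    where
    open ℕ.≤-Reasoning
    τ = s ∷ σ
    τ∖i = removeAt τ i
    a = r (A (lookup τ i))
    b = r (B (lookup τ i))
    Aᵢ⊆B : ∀ j → A (lookup τ i) ⊆ B (lookup τ∖i j)
    Aᵢ⊆B j rewrite lookup-removeAt τ i j =
      proj₁ (star i _ (removeAt-index≢ τ i j ∘ sym))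
    bound : length τ∖i * r U + a ≤ sumB τ∖i + r U
    bound = star-bound τ∖i (IsStar-removeAt τ i star) (λ _ _ → _) (λ _ → _) Aᵢ⊆B

  size≥rank : ∀ s t σ → IsStar (s ∷ σ) → IsStar (t ∷ s ∷ σ) → size r s σ ≥ + r (A t)
  size≥rank s t σ star star′ rewrite size≡ s σ =
    m+n≤p⇒m≤p-n (r (A t)) (length σ * r U) (sumB (s ∷ σ))
      (ℕ.+-cancelˡ-≤ (r U) _ _ (begin
        r U + (r (A t) + length σ * r U)  ≡⟨ x∙yz≈y∙xz (r U) (r (A t)) _ ⟩
        r (A t) + (r U + length σ * r U)  ≡⟨ ℕ.+-comm (r (A t)) _ ⟩
        (r U + length σ * r U) + r (A t)  ≤⟨ bound ⟩
        sumB (s ∷ σ) + r U                ≡⟨ ℕ.+-comm _ (r U) ⟩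
        r U + sumB (s ∷ σ)                ∎))
    where
    open ℕ.≤-Reasoning
    bound : length (s ∷ σ) * r U + r (A t) ≤ sumB (s ∷ σ) + r U
    bound = star-bound (s ∷ σ) star (λ _ _ → _) (λ _ → _)
              (λ j → proj₁ (star′ zero (suc j) λ ()))

lemma2p12 : {V : Set} (S : Pred (Sep V) 0ℓ) → IsUniverse S →
    (r : Pred V 0ℓ → ℕ) → IsSubmodularRank r →
    ((s : Sep V) (σ : List (Sep V)) → All S (s ∷ σ) → IsStar (s ∷ σ) →
      (i : Fin (length (s ∷ σ))) →
      size r s σ ≥ ∣ A (lookup (s ∷ σ) i) , B (lookup (s ∷ σ) i) ∣[ r ])
    × ((s t : Sep V) (σ : List (Sep V)) → All S (t ∷ s ∷ σ) →
      IsStar (s ∷ σ) → IsStar (t ∷ s ∷ σ) →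
      size r s σ ≥ + r (A t))
lemma2p12 _ _ _ R =
  (λ s σ _ → size≥order R s σ) , (λ s t σ _ → size≥rank R s t σ)
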